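{- For any two graphs $G$ and $H$, \[ \max\{\min\{\gamma(G),\gamma_{t}(\overline{H})\},\ \min\{\gamma(H),\gamma_{t}(\overline{G})\}\}\leq\gamma(G\diamond H). \]
   Context: All graphs are finite, simple and undirected. For a graph $G$, $\overline{G}$ denotes its complement (same vertex set, two distinct vertices adjacent iff they are not adjacent in $G$). The modular product $G\diamond H$ of graphs $G$ and $H$ has vertex set $V(G)\times V(H)$, and two distinct vertices $(g,h)$ and $(g',h')$ are adjacent iff either ($g=g'$ and $hh'\in E(H)$), or ($gg'\in E(G)$ and $h=h'$), or ($gg'\in E(G)$ and $hh'\in E(H)$), or ($g\neq g'$, $h\neq h'$, $gg'\notin E(G)$ and $hh'\notin E(H)$). A set $D\subseteq V(G)$ is a dominating set if every vertex outside $D$ has a neighbor in $D$; $\gamma(G)$ is the minimum size of a dominating set. A set $D$ is a total dominating set if every vertex of $G$ has a neighbor in $D$; $\gamma_t(G)$ is the minimum size of a total dominating set, and $\gamma_t(G)=\infty$ if no such set exists (i.e. if $G$ has an isolated vertex). -}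

module Defs where

open import Data.Nat using (ℕ; zero; suc; _*_; _≤_)
import Data.Nat as ℕ
open import Data.Bool using (Bool; true; false; _∧_; _∨_; not; if_then_else_)
open import Data.Fin using (Fin; remQuot; _≟_)
open import Data.Fin.Properties using (any?; all?)
open import Data.Fin.Subset using (Subset; _∈_; ∣_∣)
open import Data.Fin.Subset.Properties using (_∈?_)
open import Data.Vec using ([]; _∷_)
open import Data.List using (List; []; _∷_; map; _++_; foldr)
open import Data.Product using (∃; _×_; _,_)
open import Data.Sum using (_⊎_)
open import Relation.Binary.PropositionalEquality using (_≡_)
open import Relation.Nullary using (Dec; yes; no; ¬_)
open import Relation.Nullary.Decidable using (⌊_⌋; _⊎-dec_; _×-dec_)
open import Data.Bool.Properties using () renaming (_≟_ to _≟B_)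

record RawGraph : Set where
  field
    n   : ℕ
    adj : Fin n → Fin n → Bool
open RawGraph public

record Graph : Set where
  field
    raw    : RawGraph
    sym    : ∀ u v → adj raw u v ≡ adj raw v u
    irrefl : ∀ v → adj raw v v ≡ false
open Graph public

complement : RawGraph → RawGraph
complement G = record
  { n   = n G
  ; adj = λ u v → not (adj G u v) ∧ not ⌊ u ≟ v ⌋ }

-- Modular product; the vertex (g , h) of V(G) × V(H) is encoded as an
-- element of Fin (n G * n H) via remQuot / combine.
_◇_ : RawGraph → RawGraph → RawGraph
G ◇ H = record
  { n   = n G * n H
  ; adj = λ x y → prodAdj (remQuot (n H) x) (remQuot (n H) y) }
  where
  prodAdj : (Fin (n G) × Fin (n H)) → (Fin (n G) × Fin (n H)) → Bool
  prodAdj (g , h) (g' , h') =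
    let eg = ⌊ g ≟ g' ⌋ ; eh = ⌊ h ≟ h' ⌋
        aG = adj G g g' ; aH = adj H h h'
    in not (eg ∧ eh) ∧
       ( (eg ∧ aH)
       ∨ (aG ∧ eh)
       ∨ (aG ∧ aH)
       ∨ (not eg ∧ not eh ∧ not aG ∧ not aH))

Dominating : (G : RawGraph) → Subset (n G) → Set
Dominating G D = ∀ v → v ∈ D ⊎ ∃ λ u → u ∈ D × adj G v u ≡ true

TotalDominating : (G : RawGraph) → Subset (n G) → Set
TotalDominating G D = ∀ v → ∃ λ u → u ∈ D × adj G v u ≡ true

dominating? : (G : RawGraph) → (D : Subset (n G)) → Dec (Dominating G D)
dominating? G D = all? λ v → (v ∈? D) ⊎-dec any? λ u → (u ∈? D) ×-dec (adj G v u ≟B true)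

totalDominating? : (G : RawGraph) → (D : Subset (n G)) → Dec (TotalDominating G D)
totalDominating? G D = all? λ v → any? λ u → (u ∈? D) ×-dec (adj G v u ≟B true)

data ℕ∞ : Set where
  fin : ℕ → ℕ∞
  ∞   : ℕ∞

min∞ : ℕ∞ → ℕ∞ → ℕ∞
min∞ (fin a) (fin b) = fin (ℕ._⊓_ a b)
min∞ (fin a) ∞       = fin a
min∞ ∞       b       = b

max∞ : ℕ∞ → ℕ∞ → ℕ∞
max∞ (fin a) (fin b) = fin (ℕ._⊔_ a b)
max∞ (fin a) ∞       = ∞
max∞ ∞       b       = ∞

data _≤∞_ : ℕ∞ → ℕ∞ → Set where
  fin≤fin : ∀ {a b} → a ≤ b → fin a ≤∞ fin b
  x≤∞     : ∀ {x} → x ≤∞ ∞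

allSubsets : ∀ k → List (Subset k)
allSubsets zero    = [] ∷ []
allSubsets (suc k) = map (Data.Fin.Subset.inside ∷_) (allSubsets k)
                  ++ map (Data.Fin.Subset.outside ∷_) (allSubsets k)

minSize : ∀ {k} {P : Subset k → Set} → (∀ D → Dec (P D)) → ℕ∞
minSize {k} P? = foldr step ∞ (allSubsets k)
  where
  step : Subset k → ℕ∞ → ℕ∞
  step D acc with P? D
  ... | yes _ = min∞ (fin ∣ D ∣) acc
  ... | no  _ = acc

γ : RawGraph → ℕ∞
γ G = minSize (dominating? G)

-- γ_t(G): minimum size of a total dominating set; ∞ if none exists.
γₜ : RawGraph → ℕ∞
γₜ G = minSize (totalDominating? G)

-- Let D be a dominating set of G ◇ H and let D_G, D_H be its projections
-- to the two factors; neither is larger than D. If D_H totally dominates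
-- the complement of H we are done. Otherwise some h has no neighbour of
-- D_H in the complement of H, i.e. h equals or is adjacent in H to every
-- vertex of D_H. Then D_G dominates G: a vertex g outside D_G has its copy
-- (g , h) dominated by some (g' , h') ∈ D with g' ≠ g, and the definition
-- of the modular product forces g g' ∈ E(G), since h h' ∉ E(H̄). The other
-- half of the maximum is symmetric.
module Submission where

open import Defs hiding (sym)
open import Data.Nat using (suc; _+_; _≤_; z≤n; s≤s)
open import Data.Nat.Properties
  using (≤-refl; ≤-trans; ≤-reflexive; n≤1+n; +-suc; +-monoʳ-≤; ⊓-glb; ⊔-lub; m⊓n≤m; m⊓n≤n; module ≤-Reasoning)
open import Data.Bool using (Bool; true; false; _∧_; _∨_; not)
open import Data.Bool.Properties using () renaming (_≟_ to _≟ᵇ_)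
open import Data.Fin using (Fin; zero; suc; remQuot; combine; _≟_)
open import Data.Fin.Properties using (any?; ¬∀⟶∃¬; remQuot-combine)
open import Data.Fin.Subset using (Subset; inside; outside; _∈_; ∣_∣; ⊥; ⁅_⁆; _∪_)
open import Data.Fin.Subset.Properties using (_∈?_; ∣⊥∣≡0; ∣⁅x⁆∣≡1; x∈⁅x⁆; x∈p∪q⁺)
open import Data.Vec using ([]; _∷_; here; there)
open import Data.List using ([]; _∷_; map; foldr)
import Data.List.Membership.Propositional as List
open import Data.List.Membership.Propositional.Properties using (∈-map⁺; ∈-++⁺ˡ; ∈-++⁺ʳ)
open import Data.List.Relation.Unary.Any using () renaming (here to hereᴸ; there to thereᴸ)
open import Data.Product using (Σ; ∃; _×_; _,_; proj₁; proj₂; swap)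
import Data.Product as Product
open import Data.Sum using (_⊎_; inj₁; inj₂)
open import Function using (_∘_)
open import Relation.Binary.PropositionalEquality using (_≡_; _≢_; refl; sym; trans; cong; subst)
open import Relation.Nullary using (Dec; yes; no; ¬_; contradiction)
open import Relation.Nullary.Decidable using (⌊_⌋; _×-dec_; dec-false; isYes≗does)

≤∞-refl : ∀ {a} → a ≤∞ a
≤∞-refl {fin a} = fin≤fin ≤-refl
≤∞-refl {∞}     = x≤∞

≤∞-trans : ∀ {a b c} → a ≤∞ b → b ≤∞ c → a ≤∞ c
≤∞-trans (fin≤fin a≤b) (fin≤fin b≤c) = fin≤fin (≤-trans a≤b b≤c)
≤∞-trans _             x≤∞           = x≤∞

min∞-≤ˡ : ∀ a b → min∞ a b ≤∞ a
min∞-≤ˡ (fin a) (fin b) = fin≤fin (m⊓n≤m a b)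
min∞-≤ˡ (fin a) ∞       = ≤∞-refl
min∞-≤ˡ ∞       b       = x≤∞

min∞-≤ʳ : ∀ a b → min∞ a b ≤∞ b
min∞-≤ʳ (fin a) (fin b) = fin≤fin (m⊓n≤n a b)
min∞-≤ʳ (fin a) ∞       = x≤∞
min∞-≤ʳ ∞       b       = ≤∞-refl

min∞-glb : ∀ {x a b} → x ≤∞ a → x ≤∞ b → x ≤∞ min∞ a b
min∞-glb (fin≤fin x≤a) (fin≤fin x≤b) = fin≤fin (⊓-glb x≤a x≤b)
min∞-glb (fin≤fin x≤a) x≤∞           = fin≤fin x≤a
min∞-glb x≤∞           x≤b           = x≤b

max∞-lub : ∀ {a b c} → a ≤∞ c → b ≤∞ c → max∞ a b ≤∞ c
max∞-lub (fin≤fin a≤c) (fin≤fin b≤c) = fin≤fin (⊔-lub a≤c b≤c)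
max∞-lub _             x≤∞           = x≤∞

∈-allSubsets : ∀ {k} (D : Subset k) → D List.∈ allSubsets k
∈-allSubsets []                  = hereᴸ refl
∈-allSubsets {suc k} (inside ∷ D)  = ∈-++⁺ˡ (∈-map⁺ (inside ∷_) (∈-allSubsets D))
∈-allSubsets {suc k} (outside ∷ D) =
  ∈-++⁺ʳ (map (inside ∷_) (allSubsets k)) (∈-map⁺ (outside ∷_) (∈-allSubsets D))

module _ {k} {P : Subset k → Set} (P? : ∀ D → Dec (P D)) where

  -- The step function folded by minSize is local to its where block;
  -- unification against the unfolded minSize recovers it.
  private
    unfold : Σ (Subset k → ℕ∞ → ℕ∞) λ step → minSize P? ≡ foldr step ∞ (allSubsets k)
    unfold = _ , refl

    step : Subset k → ℕ∞ → ℕ∞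
    step = proj₁ unfold

    step-≤ : ∀ D acc → step D acc ≤∞ acc
    step-≤ D acc with P? D
    ... | yes _ = min∞-≤ʳ (fin ∣ D ∣) acc
    ... | no  _ = ≤∞-refl

    step-≤∣D∣ : ∀ {D} acc → P D → step D acc ≤∞ fin ∣ D ∣
    step-≤∣D∣ {D} acc p with P? D
    ... | yes _  = min∞-≤ˡ (fin ∣ D ∣) acc
    ... | no  ¬p = contradiction p ¬p

    step-glb : ∀ {x} D {acc} → (P D → x ≤∞ fin ∣ D ∣) → x ≤∞ acc → x ≤∞ step D acc
    step-glb D bound x≤acc with P? D
    ... | yes p = min∞-glb (bound p) x≤acc
    ... | no  _ = x≤acc

    foldr-≤ : ∀ {D} Ds → D List.∈ Ds → P D → foldr step ∞ Ds ≤∞ fin ∣ D ∣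
    foldr-≤ (_ ∷ _)  (hereᴸ refl) p = step-≤∣D∣ _ p
    foldr-≤ (D ∷ Ds) (thereᴸ D∈)  p = ≤∞-trans (step-≤ D _) (foldr-≤ Ds D∈ p)

    foldr-glb : ∀ {x} → (∀ D → P D → x ≤∞ fin ∣ D ∣) → ∀ Ds → x ≤∞ foldr step ∞ Ds
    foldr-glb bound []       = x≤∞
    foldr-glb bound (D ∷ Ds) = step-glb D (bound D) (foldr-glb bound Ds)

  minSize-≤ : ∀ {D} → P D → minSize P? ≤∞ fin ∣ D ∣
  minSize-≤ {D} = foldr-≤ (allSubsets k) (∈-allSubsets D)

  minSize-glb : ∀ {x} → (∀ D → P D → x ≤∞ fin ∣ D ∣) → x ≤∞ minSize P?
  minSize-glb bound = foldr-glb bound (allSubsets k)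

∣p∪q∣≤∣p∣+∣q∣ : ∀ {n} (p q : Subset n) → ∣ p ∪ q ∣ ≤ ∣ p ∣ + ∣ q ∣
∣p∪q∣≤∣p∣+∣q∣ []            []            = z≤n
∣p∪q∣≤∣p∣+∣q∣ (inside  ∷ p) (inside  ∷ q) =
  s≤s (≤-trans (∣p∪q∣≤∣p∣+∣q∣ p q) (+-monoʳ-≤ ∣ p ∣ (n≤1+n ∣ q ∣)))
∣p∪q∣≤∣p∣+∣q∣ (inside  ∷ p) (outside ∷ q) = s≤s (∣p∪q∣≤∣p∣+∣q∣ p q)
∣p∪q∣≤∣p∣+∣q∣ (outside ∷ p) (inside  ∷ q) =
  ≤-trans (s≤s (∣p∪q∣≤∣p∣+∣q∣ p q)) (≤-reflexive (sym (+-suc ∣ p ∣ ∣ q ∣)))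
∣p∪q∣≤∣p∣+∣q∣ (outside ∷ p) (outside ∷ q) = ∣p∪q∣≤∣p∣+∣q∣ p q

image : ∀ {m n} → (Fin m → Fin n) → Subset m → Subset n
image f []            = ⊥
image f (outside ∷ S) = image (f ∘ suc) S
image f (inside  ∷ S) = ⁅ f zero ⁆ ∪ image (f ∘ suc) S

∈-image : ∀ {m n} (f : Fin m → Fin n) {S s} → s ∈ S → f s ∈ image f S
∈-image f {inside  ∷ S} here       = x∈p∪q⁺ (inj₁ (x∈⁅x⁆ (f zero)))
∈-image f {inside  ∷ S} (there s∈) = x∈p∪q⁺ (inj₂ (∈-image (f ∘ suc) s∈))
∈-image f {outside ∷ S} (there s∈) = ∈-image (f ∘ suc) s∈

∣image∣≤∣S∣ : ∀ {m n} (f : Fin m → Fin n) S → ∣ image f S ∣ ≤ ∣ S ∣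
∣image∣≤∣S∣ {n = n} f [] = ≤-reflexive (∣⊥∣≡0 n)
∣image∣≤∣S∣ f (outside ∷ S) = ∣image∣≤∣S∣ (f ∘ suc) S
∣image∣≤∣S∣ f (inside  ∷ S) = begin
  ∣ ⁅ f zero ⁆ ∪ image (f ∘ suc) S ∣       ≤⟨ ∣p∪q∣≤∣p∣+∣q∣ ⁅ f zero ⁆ _ ⟩
  ∣ ⁅ f zero ⁆ ∣ + ∣ image (f ∘ suc) S ∣   ≡⟨ cong (_+ ∣ image (f ∘ suc) S ∣) (∣⁅x⁆∣≡1 (f zero)) ⟩
  suc ∣ image (f ∘ suc) S ∣                ≤⟨ s≤s (∣image∣≤∣S∣ (f ∘ suc) S) ⟩
  suc ∣ S ∣                                ∎
  where open ≤-Reasoning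

NoNeighbourIn : (G : RawGraph) → Subset (n G) → Fin (n G) → Set
NoNeighbourIn G T v = ¬ ∃ λ u → u ∈ T × adj G v u ≡ true

totalDominating⊎noNeighbourIn : (G : RawGraph) (T : Subset (n G)) →
                                TotalDominating G T ⊎ ∃ (NoNeighbourIn G T)
totalDominating⊎noNeighbourIn G T with totalDominating? G T
... | yes dom  = inj₁ dom
... | no  ¬dom = inj₂ (¬∀⟶∃¬ (n G) _ (λ v → any? λ u → (u ∈? T) ×-dec (adj G v u ≟ᵇ true)) ¬dom)

module _ {P G H : RawGraph}
         (π₁ : Fin (n P) → Fin (n G)) (π₂ : Fin (n P) → Fin (n H))
         (pairing : ∀ g h → ∃ λ x → π₁ x ≡ g × π₂ x ≡ h)
         (edge : ∀ {x y} → adj P x y ≡ true → π₁ x ≢ π₁ y →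
                 adj G (π₁ x) (π₁ y) ≡ true ⊎ adj (complement H) (π₂ x) (π₂ y) ≡ true)
         {D : Subset (n P)} (D-dom : Dominating P D)
  where

  image-dominating : ∀ {h} → NoNeighbourIn (complement H) (image π₂ D) h →
                     Dominating G (image π₁ D)
  image-dominating {h} lonely g with g ∈? image π₁ D
  ... | yes g∈ = inj₁ g∈
  ... | no  g∉ with pairing g h
  ...   | x , refl , refl with D-dom x
  ...     | inj₁ x∈D = contradiction (∈-image π₁ x∈D) g∉
  ...     | inj₂ (y , y∈D , xy)
            with edge xy (λ x≡y → g∉ (subst (_∈ image π₁ D) (sym x≡y) (∈-image π₁ y∈D)))
  ...       | inj₁ gy = inj₂ (π₁ y , ∈-image π₁ y∈D , gy)
  ...       | inj₂ hy = contradiction (π₂ y , ∈-image π₂ y∈D , hy) lonely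

  projection-bound : min∞ (γ G) (γₜ (complement H)) ≤∞ fin ∣ D ∣
  projection-bound with totalDominating⊎noNeighbourIn (complement H) (image π₂ D)
  ... | inj₁ tdom =
    ≤∞-trans (min∞-≤ʳ (γ G) _)
      (≤∞-trans (minSize-≤ (totalDominating? (complement H)) tdom) (fin≤fin (∣image∣≤∣S∣ π₂ D)))
  ... | inj₂ (_ , lonely) =
    ≤∞-trans (min∞-≤ˡ _ (γₜ (complement H)))
      (≤∞-trans (minSize-≤ (dominating? G) (image-dominating lonely)) (fin≤fin (∣image∣≤∣S∣ π₁ D)))

⌊⌋-false : ∀ {A : Set} (a? : Dec A) → ¬ A → ⌊ a? ⌋ ≡ false
⌊⌋-false a? ¬a = trans (isYes≗does a?) (dec-false a? ¬a)

-- adj (G ◇ H) x y unfolds to this, applied to the equality and adjacency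
-- bits of the coordinates of x and y.
modularAdj : (eg eh aG aH : Bool) → Bool
modularAdj eg eh aG aH =
  not (eg ∧ eh) ∧ ((eg ∧ aH) ∨ (aG ∧ eh) ∨ (aG ∧ aH) ∨ (not eg ∧ not eh ∧ not aG ∧ not aH))

modularAdj-fst : ∀ eg eh aG aH → modularAdj eg eh aG aH ≡ true → eg ≡ false →
                 aG ≡ true ⊎ not aH ∧ not eh ≡ true
modularAdj-fst false eh    true  aH    _  _ = inj₁ refl
modularAdj-fst false false false false _  _ = inj₂ refl
modularAdj-fst false false false true  () _
modularAdj-fst false true  false aH    () _
modularAdj-fst true  eh    aG    aH    _  ()

modularAdj-snd : ∀ eg eh aG aH → modularAdj eg eh aG aH ≡ true → eh ≡ false →
                 aH ≡ true ⊎ not aG ∧ not eg ≡ true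
modularAdj-snd eg    false aG    true  _  _ = inj₁ refl
modularAdj-snd false false false false _  _ = inj₂ refl
modularAdj-snd false false true  false () _
modularAdj-snd true  false true  false () _
modularAdj-snd true  false false false () _
modularAdj-snd eg    true  aG    aH    _  ()

module _ (G H : RawGraph) where

  πG : Fin (n (G ◇ H)) → Fin (n G)
  πG = proj₁ ∘ remQuot {n G} (n H)

  πH : Fin (n (G ◇ H)) → Fin (n H)
  πH = proj₂ ∘ remQuot {n G} (n H)

  ◇-pairing : ∀ g h → ∃ λ x → πG x ≡ g × πH x ≡ h
  ◇-pairing g h = combine g h , cong proj₁ remQuot-combine-gh , cong proj₂ remQuot-combine-gh
    where remQuot-combine-gh = remQuot-combine {n G} {n H} g h

  ◇-edgeG : ∀ {x y} → adj (G ◇ H) x y ≡ true → πG x ≢ πG y →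
            adj G (πG x) (πG y) ≡ true ⊎ adj (complement H) (πH x) (πH y) ≡ true
  ◇-edgeG {x} {y} xy ≢ =
    modularAdj-fst ⌊ πG x ≟ πG y ⌋ ⌊ πH x ≟ πH y ⌋ (adj G (πG x) (πG y)) (adj H (πH x) (πH y))
                   xy (⌊⌋-false (πG x ≟ πG y) ≢)

  ◇-edgeH : ∀ {x y} → adj (G ◇ H) x y ≡ true → πH x ≢ πH y →
            adj H (πH x) (πH y) ≡ true ⊎ adj (complement G) (πG x) (πG y) ≡ true
  ◇-edgeH {x} {y} xy ≢ =
    modularAdj-snd ⌊ πG x ≟ πG y ⌋ ⌊ πH x ≟ πH y ⌋ (adj G (πG x) (πG y)) (adj H (πH x) (πH y))
                   xy (⌊⌋-false (πH x ≟ πH y) ≢)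

theorem4 : (G H : Graph) →
    max∞ (min∞ (γ (raw G)) (γₜ (complement (raw H))))
         (min∞ (γ (raw H)) (γₜ (complement (raw G))))
      ≤∞ γ (raw G ◇ raw H)
theorem4 G H = minSize-glb (dominating? (G′ ◇ H′)) λ D D-dom →
  max∞-lub (projection-bound (πG G′ H′) (πH G′ H′) (◇-pairing G′ H′) (◇-edgeG G′ H′) D-dom)
           (projection-bound (πH G′ H′) (πG G′ H′) pairing-swapped (◇-edgeH G′ H′) D-dom)
  where
  G′ H′ : RawGraph
  G′ = raw G
  H′ = raw H
  pairing-swapped : ∀ h g → ∃ λ x → πH G′ H′ x ≡ h × πG G′ H′ x ≡ g
  pairing-swapped h g = Product.map₂ swap (◇-pairing G′ H′ g h)
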